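{- Let $h>0$ and $\alpha>0$ be integers. Then for every partition $\lambda\vdash h+\alpha$ we have $f_{h,\alpha}^{\lambda}=f_{h,\alpha-1}^{\lambda}$.
   Context: For a partition $\lambda\vdash k$, $\operatorname{SYT}(\lambda)$ is the set of standard Young tableaux of shape $\lambda$ (bijective fillings of the diagram with $1,\ldots,k$ increasing along rows and down columns). For $T\in\operatorname{SYT}(\lambda)$, $R_T(m)$ is the row (counted from the top) of the box containing $m$. For $0\le h\le k$ and $0\le\alpha\le k-h$, $\operatorname{SYT}_{h,\alpha}(\lambda)$ is the set of $T\in\operatorname{SYT}(\lambda)$ with $R_T(i+1+\alpha)>R_T(i+\alpha)$ for all $1\le i<h$, and $f^{\lambda}_{h,\alpha}=|\operatorname{SYT}_{h,\alpha}(\lambda)|$. -}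

module Defs where

open import Data.Nat using (ℕ; zero; suc; _+_; _≤_; _<_; _<ᵇ_; _≡ᵇ_)
open import Data.Bool using (Bool; true; false; _∧_; if_then_else_)
open import Data.List using (List; []; _∷_; map; concat; concatMap; length; upTo; filterᵇ)
open import Data.Nat.ListAction using (sum)
open import Data.List.Relation.Unary.All using (All)
open import Data.List.Relation.Unary.Linked using (Linked)
open import Relation.Nullary.Decidable using (does)
open import Data.Nat using (_≟_)
open import Relation.Binary.PropositionalEquality using (_≡_)

record _⊢_ (λ′ : List ℕ) (k : ℕ) : Set where
  field
    positive   : All (λ p → 0 < p) λ′
    decreasing : Linked (λ a b → b ≤ a) λ′
    size       : sum λ′ ≡ k

-- Fillings / tableaux.  A filling is a list of rows (top row first),
-- each row a list of entries (left to right).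

Filling : Set
Filling = List (List ℕ)

shape : Filling → List ℕ
shape T = map length T

words : List ℕ → ℕ → List (List ℕ)
words xs zero    = [] ∷ []
words xs (suc n) = concatMap (λ x → map (x ∷_) (words xs n)) xs

fillings : List ℕ → List ℕ → List Filling
fillings xs []       = [] ∷ []
fillings xs (r ∷ λ′) = concatMap (λ row → map (row ∷_) (fillings xs λ′)) (words xs r)

allᵇ : {A : Set} → (A → Bool) → List A → Bool
allᵇ p []       = true
allᵇ p (x ∷ xs) = p x ∧ allᵇ p xs

countᵇ : ℕ → List ℕ → ℕ
countᵇ m []       = 0
countᵇ m (x ∷ xs) = if x ≡ᵇ m then suc (countᵇ m xs) else countᵇ m xs

rowIncᵇ : List ℕ → Bool
rowIncᵇ []           = true
rowIncᵇ (x ∷ [])     = true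
rowIncᵇ (x ∷ y ∷ xs) = (x <ᵇ y) ∧ rowIncᵇ (y ∷ xs)

belowᵇ : List ℕ → List ℕ → Bool
belowᵇ _        []       = true
belowᵇ []       (_ ∷ _)  = false
belowᵇ (a ∷ as) (b ∷ bs) = (a <ᵇ b) ∧ belowᵇ as bs

colIncᵇ : Filling → Bool
colIncᵇ []            = true
colIncᵇ (r ∷ [])      = true
colIncᵇ (r ∷ s ∷ rs)  = belowᵇ r s ∧ colIncᵇ (s ∷ rs)

bijectiveᵇ : ℕ → Filling → Bool
bijectiveᵇ k T =
  (length (concat T) ≡ᵇ k) ∧
  allᵇ (λ m → countᵇ m (concat T) ≡ᵇ 1) (map suc (upTo k))

-- T is a standard Young tableau (its shape is given by construction)
isSYTᵇ : ℕ → Filling → Bool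
isSYTᵇ k T = bijectiveᵇ k T ∧ allᵇ rowIncᵇ T ∧ colIncᵇ T

memᵇ : ℕ → List ℕ → Bool
memᵇ m []       = false
memᵇ m (x ∷ xs) = (x ≡ᵇ m) Data.Bool.∨ memᵇ m xs

-- R_T(m): row (counted from the top, starting at 1) of the box containing m
R : Filling → ℕ → ℕ
R []       m = 1
R (r ∷ rs) m = if memᵇ m r then 1 else suc (R rs m)

descentCondᵇ : ℕ → ℕ → Filling → Bool
descentCondᵇ h α T =
  allᵇ (λ i → R T (i + α) <ᵇ R T (i + 1 + α))
      (filterᵇ (λ i → 1 ≤ᵇ′ i) (upTo h))
  where
  _≤ᵇ′_ : ℕ → ℕ → Bool
  zero ≤ᵇ′ _ = true
  suc a ≤ᵇ′ zero = false
  suc a ≤ᵇ′ suc b = a ≤ᵇ′ b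

SYT : List ℕ → List Filling
SYT λ′ = filterᵇ (isSYTᵇ (sum λ′)) (fillings (map suc (upTo (sum λ′))) λ′)

SYT[_,_] : ℕ → ℕ → List ℕ → List Filling
SYT[ h , α ] λ′ = filterᵇ (descentCondᵇ h α) (SYT λ′)

f : List ℕ → ℕ → ℕ → ℕ
f λ′ h α = length (SYT[ h , α ] λ′)

-- Write Y i for the row of the entry α + i (0 ≤ i ≤ h).  A standard tableau is counted by f_{h,α} iff
-- Y 1 < ⋯ < Y h, and by f_{h,α-1} iff Y 0 < ⋯ < Y (h - 1).  Given the former, let c + 1 be the length of
-- the initial run Y 1, …, Y (c + 1) ≤ Y 0.  If the run is empty the tableau satisfies the latter as well;
-- otherwise relabel α, …, α + h so that the row sequence becomes Y 1, …, Y c, Y 0, Y (c + 2), …, Y h,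
-- Y (c + 1), which is increasing on [0, h - 1].  The relabelling is a product of transpositions of
-- consecutive entries lying neither in the same row nor in vertically adjacent boxes, so standardness
-- is preserved.  Cutting the row sequence at the first c with Y c ≥ Y h inverts the map.

module Submission where

open import Defs
open import Data.Bool using (Bool; true; false; _∧_; if_then_else_; T?) renaming (T to IsTrue)
open import Data.Empty using (⊥-elim)
open import Data.Nat using (ℕ; zero; suc; _+_; _∸_; _<_; _≤_; z≤n; s≤s; _<ᵇ_; _≡ᵇ_; _≤ᵇ_)
open import Data.Nat.Properties
open import Data.List using (List; []; _∷_; map; concat; concatMap; length; upTo; filterᵇ; _++_)
open import Data.Nat.ListAction using (sum)
open import Data.List.Properties
  using (concat-map; length-map; map-∘; map-cong; map-id; ∷-injectiveˡ; ∷-injectiveʳ)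
import Data.List.Relation.Unary.All as All
open import Data.List.Relation.Unary.AllPairs using ([]; _∷_)
open import Data.List.Relation.Unary.Unique.Propositional using (Unique)
import Data.List.Relation.Unary.Unique.Propositional.Properties as Unique
open import Data.List.Membership.Propositional using (_∈_; find; lose)
open import Data.List.Membership.Propositional.Properties
  using ( ∈-concatMap⁻; ∈-concatMap⁺; ∈-map⁺; ∈-map⁻; ∈-++⁺ˡ; ∈-++⁺ʳ; ∈-++⁻
        ; ∈-upTo⁺; ∈-upTo⁻; ∈-filter⁺; ∈-filter⁻)
open import Data.List.Relation.Unary.Any using (here; there)
open import Data.Product using (Σ; _×_; _,_; proj₁; proj₂)
open import Data.Sum using (_⊎_; inj₁; inj₂)
open import Relation.Nullary using (¬_; yes; no)
open import Relation.Binary.Definitions using (tri<; tri≈; tri>)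
open import Relation.Binary.PropositionalEquality
open import Function using (_∘′_; id; _⇔_; mk⇔; Equivalence)

IsTrue-∧ˡ : ∀ {a b} → IsTrue (a ∧ b) → IsTrue a
IsTrue-∧ˡ {true} _ = _

IsTrue-∧ʳ : ∀ {a b} → IsTrue (a ∧ b) → IsTrue b
IsTrue-∧ʳ {true} t = t

IsTrue-∧⁺ : ∀ {a b} → IsTrue a → IsTrue b → IsTrue (a ∧ b)
IsTrue-∧⁺ {true} _ t = t

≡ᵇ-refl : ∀ m → (m ≡ᵇ m) ≡ true
≡ᵇ-refl zero    = refl
≡ᵇ-refl (suc m) = ≡ᵇ-refl m

≢⇒≡ᵇ-false : ∀ m n → m ≢ n → (m ≡ᵇ n) ≡ false
≢⇒≡ᵇ-false zero    zero    m≢n = ⊥-elim (m≢n refl)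
≢⇒≡ᵇ-false zero    (suc n) _   = refl
≢⇒≡ᵇ-false (suc m) zero    _   = refl
≢⇒≡ᵇ-false (suc m) (suc n) m≢n = ≢⇒≡ᵇ-false m n (m≢n ∘′ cong suc)

≡ᵇ-true⇒≡ : ∀ m n → (m ≡ᵇ n) ≡ true → m ≡ n
≡ᵇ-true⇒≡ m n eq = ≡ᵇ⇒≡ m n (subst IsTrue (sym eq) _)

≡ᵇ-involution : (g : ℕ → ℕ) → (∀ x → g (g x) ≡ x) → ∀ x m → (g x ≡ᵇ m) ≡ (x ≡ᵇ g m)
≡ᵇ-involution g inv x m with x ≟ g m
... | yes refl rewrite inv m | ≡ᵇ-refl m | ≡ᵇ-refl (g m) = refl
... | no x≢gm rewrite ≢⇒≡ᵇ-false x (g m) x≢gm =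
  ≢⇒≡ᵇ-false (g x) m (λ e → x≢gm (trans (sym (inv x)) (cong g e)))

swap : ℕ → ℕ → ℕ
swap v m = if m ≡ᵇ v then suc v else (if m ≡ᵇ suc v then v else m)

swap-left : ∀ v → swap v v ≡ suc v
swap-left v rewrite ≡ᵇ-refl v = refl

swap-right : ∀ v → swap v (suc v) ≡ v
swap-right v rewrite ≢⇒≡ᵇ-false (suc v) v 1+n≢n | ≡ᵇ-refl v = refl

swap-other : ∀ v m → m ≢ v → m ≢ suc v → swap v m ≡ m
swap-other v m m≢v m≢sv rewrite ≢⇒≡ᵇ-false m v m≢v | ≢⇒≡ᵇ-false m (suc v) m≢sv = refl

swap-outside : ∀ v m → m < v ⊎ suc v < m → swap v m ≡ m
swap-outside v m (inj₁ m<v) = swap-other v m (<⇒≢ m<v) (<⇒≢ (m<n⇒m<1+n m<v))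
swap-outside v m (inj₂ sv<m) = swap-other v m (≢-sym (<⇒≢ (<-trans (n<1+n v) sv<m))) (≢-sym (<⇒≢ sv<m))

swap-involutive : ∀ v m → swap v (swap v m) ≡ m
swap-involutive v m with m ≟ v
... | yes refl rewrite swap-left v = swap-right v
... | no m≢v with m ≟ suc v
...   | yes refl rewrite swap-right v = swap-left v
...   | no m≢sv rewrite swap-other v m m≢v m≢sv = swap-other v m m≢v m≢sv

swap-< : ∀ v a b → a < b → ¬ (a ≡ v × b ≡ suc v) → swap v a < swap v b
swap-< v a b a<b ¬vsv with a ≟ v | b ≟ v | a ≟ suc v | b ≟ suc v
... | yes refl | yes refl | _        | _        = ⊥-elim (<-irrefl refl a<b)
... | yes refl | no _     | _        | yes refl = ⊥-elim (¬vsv (refl , refl))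
... | yes refl | no b≢v   | _        | no b≢sv
  rewrite swap-left v | swap-other v b b≢v b≢sv = ≤∧≢⇒< a<b (≢-sym b≢sv)
... | no _     | yes refl | yes refl | _        = ⊥-elim (<-asym a<b (n<1+n v))
... | no a≢v   | yes refl | no a≢sv  | _
  rewrite swap-other v a a≢v a≢sv | swap-left v = m<n⇒m<1+n a<b
... | no _     | no _     | yes refl | yes refl = ⊥-elim (<-irrefl refl a<b)
... | no _     | no b≢v   | yes refl | no b≢sv
  rewrite swap-right v | swap-other v b b≢v b≢sv = <-trans (n<1+n v) a<b
... | no a≢v   | no _     | no a≢sv  | yes refl
  rewrite swap-other v a a≢v a≢sv | swap-right v = ≤∧≢⇒< (≤-pred a<b) a≢v
... | no a≢v   | no b≢v   | no a≢sv  | no b≢sv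
  rewrite swap-other v a a≢v a≢sv | swap-other v b b≢v b≢sv = a<b

count-++ : ∀ m xs ys → countᵇ m (xs ++ ys) ≡ countᵇ m xs + countᵇ m ys
count-++ m []       ys = refl
count-++ m (x ∷ xs) ys with x ≡ᵇ m
... | true  = cong suc (count-++ m xs ys)
... | false = count-++ m xs ys

∈⇒count-pos : ∀ {m xs} → m ∈ xs → 0 < countᵇ m xs
∈⇒count-pos {m} (here refl) rewrite ≡ᵇ-refl m = s≤s z≤n
∈⇒count-pos {m} {x ∷ _} (there m∈) with x ≡ᵇ m
... | true  = s≤s z≤n
... | false = ∈⇒count-pos m∈

count-pos⇒∈ : ∀ {m} xs → 0 < countᵇ m xs → m ∈ xs
count-pos⇒∈ {m} (x ∷ xs) pos with x ≡ᵇ m in eq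
... | true  = here (sym (≡ᵇ-true⇒≡ x m eq))
... | false = there (count-pos⇒∈ xs pos)

count-map : (g : ℕ → ℕ) → (∀ x → g (g x) ≡ x) → ∀ m xs → countᵇ m (map g xs) ≡ countᵇ (g m) xs
count-map g inv m []       = refl
count-map g inv m (x ∷ xs) rewrite ≡ᵇ-involution g inv x m | count-map g inv m xs = refl

memᵇ⇒∈ : ∀ m r → memᵇ m r ≡ true → m ∈ r
memᵇ⇒∈ m (x ∷ r) mem with x ≡ᵇ m in eq
... | true  = here (sym (≡ᵇ-true⇒≡ x m eq))
... | false = there (memᵇ⇒∈ m r mem)

∈⇒memᵇ : ∀ {m r} → m ∈ r → memᵇ m r ≡ true
∈⇒memᵇ {m} (here refl) rewrite ≡ᵇ-refl m = refl
∈⇒memᵇ {m} {x ∷ _} (there m∈) rewrite ∈⇒memᵇ m∈ with x ≡ᵇ m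
... | true  = refl
... | false = refl

memᵇ-map : (g : ℕ → ℕ) → (∀ x → g (g x) ≡ x) → ∀ m r → memᵇ m (map g r) ≡ memᵇ (g m) r
memᵇ-map g inv m []      = refl
memᵇ-map g inv m (x ∷ r) rewrite ≡ᵇ-involution g inv x m | memᵇ-map g inv m r = refl

data RowAt : ℕ → List ℕ → Filling → Set where
  first : ∀ {r T} → RowAt 1 r (r ∷ T)
  next  : ∀ {i r r′ T} → RowAt i r T → RowAt (suc i) r (r′ ∷ T)

RowAt-functional : ∀ {i r r′ T} → RowAt i r T → RowAt i r′ T → r ≡ r′
RowAt-functional first    first    = refl
RowAt-functional (next p) (next q) = RowAt-functional p q
RowAt-functional first    (next ())
RowAt-functional (next ()) first

RowAt⇒∈ : ∀ {i r T} → RowAt i r T → r ∈ T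
RowAt⇒∈ first    = here refl
RowAt⇒∈ (next p) = there (RowAt⇒∈ p)

InRow : ℕ → ℕ → Filling → Set
InRow m i T = Σ (List ℕ) λ r → RowAt i r T × m ∈ r

InRow⇒∈ : ∀ {m i T} → InRow m i T → m ∈ concat T
InRow⇒∈ (r , first , m∈r) = ∈-++⁺ˡ m∈r
InRow⇒∈ {T = r′ ∷ _} (r , next p , m∈r) = ∈-++⁺ʳ r′ (InRow⇒∈ (r , p , m∈r))

InRow-RowAt : ∀ {m i r T} → InRow m i T → RowAt i r T → m ∈ r
InRow-RowAt (r′ , r′At , m∈r′) rAt = subst (_ ∈_) (RowAt-functional r′At rAt) m∈r′

InRow-R : ∀ {m} T → m ∈ concat T → InRow m (R T m) T
InRow-R {m} (r ∷ T) m∈ with memᵇ m r in mem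
... | true = r , first , memᵇ⇒∈ m r mem
... | false with ∈-++⁻ r m∈
...   | inj₁ m∈r = ⊥-elim (subst IsTrue (trans (sym (∈⇒memᵇ m∈r)) mem) _)
...   | inj₂ m∈T with InRow-R T m∈T
...     | r′ , p , m∈r′ = r′ , next p , m∈r′

count-zero⇒memᵇ-false : ∀ m r → countᵇ m r ≡ 0 → memᵇ m r ≡ false
count-zero⇒memᵇ-false m []      _    = refl
count-zero⇒memᵇ-false m (x ∷ r) none with x ≡ᵇ m
... | true  = ⊥-elim (1+n≢0 none)
... | false = count-zero⇒memᵇ-false m r none

+≡1⇒ : ∀ a b → a + b ≡ 1 → 0 < b → a ≡ 0 × b ≡ 1
+≡1⇒ zero    b       a+b≡1 _ = refl , a+b≡1
+≡1⇒ (suc a) (suc b) a+b≡1 _ = ⊥-elim (m+1+n≢0 a (suc-injective a+b≡1))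

InRow⇒R≡ : ∀ {m i T} → InRow m i T → countᵇ m (concat T) ≡ 1 → R T m ≡ i
InRow⇒R≡ (r , first , m∈r) _ rewrite ∈⇒memᵇ m∈r = refl
InRow⇒R≡ {m} {T = r′ ∷ T} (r , next p , m∈r) once
  with +≡1⇒ (countᵇ m r′) (countᵇ m (concat T))
             (trans (sym (count-++ m r′ (concat T))) once)
             (∈⇒count-pos (InRow⇒∈ (r , p , m∈r)))
... | none , once′ rewrite count-zero⇒memᵇ-false m r′ none = cong suc (InRow⇒R≡ (r , p , m∈r) once′)

R-map : (g : ℕ → ℕ) → (∀ x → g (g x) ≡ x) → ∀ T m → R (map (map g) T) m ≡ R T (g m)
R-map g inv []      m = refl
R-map g inv (r ∷ T) m rewrite memᵇ-map g inv m r | R-map g inv T m = refl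

data Adjacent (a b : ℕ) : List ℕ → Set where
  here₂  : ∀ {r} → Adjacent a b (a ∷ b ∷ r)
  there₂ : ∀ {x r} → Adjacent a b r → Adjacent a b (x ∷ r)

Adjacent-∈ˡ : ∀ {a b r} → Adjacent a b r → a ∈ r
Adjacent-∈ˡ here₂      = here refl
Adjacent-∈ˡ (there₂ p) = there (Adjacent-∈ˡ p)

Adjacent-∈ʳ : ∀ {a b r} → Adjacent a b r → b ∈ r
Adjacent-∈ʳ here₂      = there (here refl)
Adjacent-∈ʳ (there₂ p) = there (Adjacent-∈ʳ p)

rowIncᵇ-tail : ∀ {x} r → IsTrue (rowIncᵇ (x ∷ r)) → IsTrue (rowIncᵇ r)
rowIncᵇ-tail []      _   = _
rowIncᵇ-tail (_ ∷ _) inc = IsTrue-∧ʳ inc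

rowIncᵇ-head< : ∀ {x y} r → IsTrue (rowIncᵇ (x ∷ r)) → y ∈ r → x < y
rowIncᵇ-head< {x} (z ∷ r) inc (here refl) = <ᵇ⇒< x z (IsTrue-∧ˡ inc)
rowIncᵇ-head< {x} (z ∷ r) inc (there y∈r) =
  <-trans (<ᵇ⇒< x z (IsTrue-∧ˡ inc)) (rowIncᵇ-head< r (IsTrue-∧ʳ inc) y∈r)

rowIncᵇ-Adjacent : ∀ {a b} r → IsTrue (rowIncᵇ r) → Adjacent a b r → a < b
rowIncᵇ-Adjacent (a ∷ b ∷ _) inc here₂      = <ᵇ⇒< a b (IsTrue-∧ˡ inc)
rowIncᵇ-Adjacent (_ ∷ r)     inc (there₂ p) = rowIncᵇ-Adjacent r (rowIncᵇ-tail r inc) p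

rowIncᵇ-map : (g : ℕ → ℕ) → ∀ r → (∀ {a b} → Adjacent a b r → g a < g b) →
              IsTrue (rowIncᵇ (map g r))
rowIncᵇ-map g []          mono = _
rowIncᵇ-map g (x ∷ [])    mono = _
rowIncᵇ-map g (x ∷ y ∷ r) mono =
  IsTrue-∧⁺ (<⇒<ᵇ (mono here₂)) (rowIncᵇ-map g (y ∷ r) (mono ∘′ there₂))

rowIncᵇ-consecutive : ∀ {u} r → IsTrue (rowIncᵇ r) → u ∈ r → suc u ∈ r → Adjacent u (suc u) r
rowIncᵇ-consecutive (x ∷ r) inc (here refl) (here su≡u) = ⊥-elim (1+n≢n su≡u)
rowIncᵇ-consecutive (x ∷ []) inc (here refl) (there ())
rowIncᵇ-consecutive (x ∷ y ∷ r) inc (here refl) (there (here refl)) = here₂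
rowIncᵇ-consecutive (x ∷ y ∷ r) inc (here refl) (there (there su∈r)) =
  ⊥-elim (<-irrefl refl (≤-trans (rowIncᵇ-head< r (IsTrue-∧ʳ inc) su∈r) (<ᵇ⇒< x y (IsTrue-∧ˡ inc))))
rowIncᵇ-consecutive {u} (x ∷ r) inc (there u∈r) (here refl) =
  ⊥-elim (<-asym (rowIncᵇ-head< r inc u∈r) (n<1+n u))
rowIncᵇ-consecutive (x ∷ r) inc (there u∈r) (there su∈r) =
  there₂ (rowIncᵇ-consecutive r (rowIncᵇ-tail r inc) u∈r su∈r)

data Stacked (a b : ℕ) : List ℕ → List ℕ → Set where
  here₂  : ∀ {r s} → Stacked a b (a ∷ r) (b ∷ s)
  there₂ : ∀ {x y r s} → Stacked a b r s → Stacked a b (x ∷ r) (y ∷ s)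

Stacked-∈ˡ : ∀ {a b r s} → Stacked a b r s → a ∈ r
Stacked-∈ˡ here₂      = here refl
Stacked-∈ˡ (there₂ p) = there (Stacked-∈ˡ p)

Stacked-∈ʳ : ∀ {a b r s} → Stacked a b r s → b ∈ s
Stacked-∈ʳ here₂      = here refl
Stacked-∈ʳ (there₂ p) = there (Stacked-∈ʳ p)

belowᵇ-Stacked : ∀ {a b r s} → IsTrue (belowᵇ r s) → Stacked a b r s → a < b
belowᵇ-Stacked {a} {b} below here₂      = <ᵇ⇒< a b (IsTrue-∧ˡ below)
belowᵇ-Stacked         below (there₂ p) = belowᵇ-Stacked (IsTrue-∧ʳ below) p

belowᵇ-map : (g : ℕ → ℕ) → ∀ r s → IsTrue (belowᵇ r s) → (∀ {a b} → Stacked a b r s → g a < g b) →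
             IsTrue (belowᵇ (map g r) (map g s))
belowᵇ-map g []      []      _     _    = _
belowᵇ-map g (_ ∷ _) []      _     _    = _
belowᵇ-map g (x ∷ r) (y ∷ s) below mono =
  IsTrue-∧⁺ (<⇒<ᵇ (mono here₂)) (belowᵇ-map g r s (IsTrue-∧ʳ below) (mono ∘′ there₂))

-- The box below u is squeezed between u (above it) and u + 2 (to its right).
squeezed-below : ∀ {u} r s → IsTrue (rowIncᵇ r) → IsTrue (rowIncᵇ s) → IsTrue (belowᵇ r s) →
                 Adjacent u (suc u) r → Stacked (suc u) (suc (suc u)) r s → suc u ∈ s
squeezed-below {u} (.u ∷ _) (y ∷ z ∷ _) _ inc below here₂ (there₂ here₂) =
  here (≤-antisym (<ᵇ⇒< u y (IsTrue-∧ˡ below)) (≤-pred (<ᵇ⇒< y _ (IsTrue-∧ˡ inc))))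
squeezed-below {u} (.u ∷ .(suc u) ∷ r) (_ ∷ _ ∷ _) inc _ _ here₂ (there₂ (there₂ p)) =
  ⊥-elim (<-irrefl refl (rowIncᵇ-head< r (IsTrue-∧ʳ inc) (Stacked-∈ˡ p)))
squeezed-below (x ∷ r) (_ ∷ _) inc _ _ (there₂ p) here₂ =
  ⊥-elim (<-irrefl refl (rowIncᵇ-head< r inc (Adjacent-∈ʳ p)))
squeezed-below (x ∷ r) (y ∷ s) incr incs below (there₂ p) (there₂ q) =
  there (squeezed-below r s (rowIncᵇ-tail r incr) (rowIncᵇ-tail s incs) (IsTrue-∧ʳ below) p q)

-- The box above u + 2 is squeezed between u (to its left) and u + 2 (below it).
squeezed-above : ∀ {u} r s → IsTrue (rowIncᵇ r) → IsTrue (rowIncᵇ s) → IsTrue (belowᵇ r s) →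
                 Adjacent (suc u) (suc (suc u)) s → Stacked u (suc u) r s → suc u ∈ r
squeezed-above {u} (.u ∷ [])    _ _   _ below here₂ here₂ = ⊥-elim (IsTrue-∧ʳ below)
squeezed-above {u} (.u ∷ y ∷ _) _ inc _ below here₂ here₂ =
  there (here (≤-antisym (<ᵇ⇒< u y (IsTrue-∧ˡ inc))
                         (≤-pred (<ᵇ⇒< y _ (IsTrue-∧ˡ (IsTrue-∧ʳ {u <ᵇ suc u} below))))))
squeezed-above {u} (_ ∷ _) (.(suc u) ∷ .(suc (suc u)) ∷ s) _ inc _ here₂ (there₂ p) =
  ⊥-elim (<-irrefl refl (rowIncᵇ-head< (suc (suc u) ∷ s) inc (Stacked-∈ʳ p)))
squeezed-above (_ ∷ _) (y ∷ s) _ inc _ (there₂ p) here₂ =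
  ⊥-elim (<-irrefl refl (rowIncᵇ-head< s inc (Adjacent-∈ˡ p)))
squeezed-above (x ∷ r) (y ∷ s) incr incs below (there₂ p) (there₂ q) =
  there (squeezed-above r s (rowIncᵇ-tail r incr) (rowIncᵇ-tail s incs) (IsTrue-∧ʳ below) p q)

data Above (a b : ℕ) : Filling → Set where
  here  : ∀ {r s T} → Stacked a b r s → Above a b (r ∷ s ∷ T)
  there : ∀ {r T} → Above a b T → Above a b (r ∷ T)

record AboveWitness (a b : ℕ) (T : Filling) : Set where
  field
    i     : ℕ
    upper : List ℕ
    lower : List ℕ
    upperAt : RowAt i upper T
    lowerAt : RowAt (suc i) lower T
    stacked : Stacked a b upper lower
    below   : IsTrue (belowᵇ upper lower)

Above-witness : ∀ {a b} T → IsTrue (colIncᵇ T) → Above a b T → AboveWitness a b T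
Above-witness (r ∷ s ∷ T) inc (here p) = record
  { i = 1 ; upper = r ; lower = s ; upperAt = first ; lowerAt = next first
  ; stacked = p ; below = IsTrue-∧ˡ inc }
Above-witness (r ∷ s ∷ T) inc (there p) =
  let w = Above-witness (s ∷ T) (IsTrue-∧ʳ {belowᵇ r s} inc) p
      open AboveWitness w
  in record
  { i = suc i ; upper = upper ; lower = lower ; upperAt = next upperAt ; lowerAt = next lowerAt
  ; stacked = stacked ; below = below }

colIncᵇ-Above : ∀ {a b} T → IsTrue (colIncᵇ T) → Above a b T → a < b
colIncᵇ-Above T inc p = belowᵇ-Stacked below stacked
  where open AboveWitness (Above-witness T inc p)

colIncᵇ-map : (g : ℕ → ℕ) → ∀ T → IsTrue (colIncᵇ T) → (∀ {a b} → Above a b T → g a < g b) →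
              IsTrue (colIncᵇ (map (map g) T))
colIncᵇ-map g []          _   _    = _
colIncᵇ-map g (r ∷ [])    _   _    = _
colIncᵇ-map g (r ∷ s ∷ T) inc mono =
  IsTrue-∧⁺ (belowᵇ-map g r s (IsTrue-∧ˡ inc) (mono ∘′ here))
            (colIncᵇ-map g (s ∷ T) (IsTrue-∧ʳ {belowᵇ r s} inc) (mono ∘′ there))

allᵇ-∈ : ∀ {A : Set} (p : A → Bool) {x} xs → IsTrue (allᵇ p xs) → x ∈ xs → IsTrue (p x)
allᵇ-∈ p (y ∷ xs) all (here refl) = IsTrue-∧ˡ all
allᵇ-∈ p (y ∷ xs) all (there x∈)  = allᵇ-∈ p xs (IsTrue-∧ʳ {p y} all) x∈

allᵇ-intro : ∀ {A : Set} (p : A → Bool) xs → (∀ {x} → x ∈ xs → IsTrue (p x)) → IsTrue (allᵇ p xs)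
allᵇ-intro p []       _  = _
allᵇ-intro p (y ∷ xs) px = IsTrue-∧⁺ (px (here refl)) (allᵇ-intro p xs (px ∘′ there))

allᵇ-rowIncᵇ-map : (g : ℕ → ℕ) → ∀ T → (∀ {i r} → RowAt i r T → ∀ {a b} → Adjacent a b r → g a < g b) →
                   IsTrue (allᵇ rowIncᵇ (map (map g) T))
allᵇ-rowIncᵇ-map g []      _    = _
allᵇ-rowIncᵇ-map g (r ∷ T) mono =
  IsTrue-∧⁺ (rowIncᵇ-map g r (mono first)) (allᵇ-rowIncᵇ-map g T (mono ∘′ next))

words-map : (g : ℕ → ℕ) → ∀ xs n {w} → (∀ {y} → y ∈ xs → g y ∈ xs) →
            w ∈ words xs n → map g w ∈ words xs n
words-map g xs zero    closed (here refl) = here refl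
words-map g xs (suc n) closed w∈
  with x , x∈ , w∈x ← find (∈-concatMap⁻ (λ x → map (x ∷_) (words xs n)) {xs = xs} w∈)
  with w′ , w′∈ , refl ← ∈-map⁻ (x ∷_) w∈x =
  ∈-concatMap⁺ (λ y → map (y ∷_) (words xs n))
    (lose (closed x∈) (∈-map⁺ (g x ∷_) (words-map g xs n closed w′∈)))

fillings-map : (g : ℕ → ℕ) → ∀ xs λ′ {T} → (∀ {y} → y ∈ xs → g y ∈ xs) →
               T ∈ fillings xs λ′ → map (map g) T ∈ fillings xs λ′
fillings-map g xs []            closed (here refl) = here refl
fillings-map g xs (len ∷ λ′) closed T∈
  with row , row∈ , T∈row ← find (∈-concatMap⁻ (λ row → map (row ∷_) (fillings xs λ′))
                                                {xs = words xs len} T∈)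
  with T′ , T′∈ , refl ← ∈-map⁻ (row ∷_) T∈row =
  ∈-concatMap⁺ (λ row → map (row ∷_) (fillings xs λ′))
    (lose (words-map g xs len closed row∈) (∈-map⁺ (map g row ∷_) (fillings-map g xs λ′ closed T′∈)))

module _ {A B : Set} where

  private
    remove : ∀ {y : B} ys → y ∈ ys →
             Σ (List B) λ ys′ → length ys ≡ suc (length ys′) × (∀ {z} → z ∈ ys → z ≢ y → z ∈ ys′)
    remove (y ∷ ys) (here refl) =
      ys , refl , λ { (here refl) z≢y → ⊥-elim (z≢y refl) ; (there z∈) _ → z∈ }
    remove (w ∷ ws) (there y∈) with ws′ , len , keep ← remove ws y∈ =
      w ∷ ws′ , cong suc len , λ { (here refl) _ → here refl ; (there z∈) z≢y → there (keep z∈ z≢y) }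

  length-≤-injection : (g : A → B) → ∀ xs ys → Unique xs → (∀ {x} → x ∈ xs → g x ∈ ys) →
                       (∀ {a b} → a ∈ xs → b ∈ xs → g a ≡ g b → a ≡ b) → length xs ≤ length ys
  length-≤-injection g []       ys _              _     _   = z≤n
  length-≤-injection g (x ∷ xs) ys (x∉xs ∷ uniq) into inj
    with ys′ , len , keep ← remove ys (into (here refl)) =
    subst (suc (length xs) ≤_) (sym len) (s≤s (length-≤-injection g xs ys′ uniq
      (λ x′∈ → keep (into (there x′∈))
                    λ e → All.lookup x∉xs x′∈ (sym (inj (there x′∈) (here refl) e)))
      (λ a∈ b∈ → inj (there a∈) (there b∈))))

module _ {A : Set} where

  length-filterᵇ-≤ : ∀ xs → Unique xs → (p q : A → Bool) (g g⁻¹ : A → A) →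
                     (∀ {x} → x ∈ xs → IsTrue (p x) → (g x ∈ xs × IsTrue (q (g x))) × g⁻¹ (g x) ≡ x) →
                     length (filterᵇ p xs) ≤ length (filterᵇ q xs)
  length-filterᵇ-≤ xs uniq p q g g⁻¹ maps =
    length-≤-injection g (filterᵇ p xs) (filterᵇ q xs) (Unique.filter⁺ (λ x → T? (p x)) uniq)
      (λ x∈ → let x∈xs , px = ∈-filter⁻ (λ x → T? (p x)) {xs = xs} x∈
                  (gx∈ , qgx) , _ = maps x∈xs px
              in ∈-filter⁺ (λ x → T? (q x)) gx∈ qgx)
      (λ a∈ b∈ e → let a∈xs , pa = ∈-filter⁻ (λ x → T? (p x)) {xs = xs} a∈
                       b∈xs , pb = ∈-filter⁻ (λ x → T? (p x)) {xs = xs} b∈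
                   in trans (sym (proj₂ (maps a∈xs pa))) (trans (cong g⁻¹ e) (proj₂ (maps b∈xs pb))))

concatMap-unique : ∀ {A B : Set} (g : A → List B) xs → Unique xs → (∀ x → Unique (g x)) →
                   (∀ {x y w} → w ∈ g x → w ∈ g y → x ≡ y) → Unique (concatMap g xs)
concatMap-unique g []       _              _    _        = []
concatMap-unique g (x ∷ xs) (x∉xs ∷ uniq) gu disjoint =
  Unique.++⁺ (gu x) (concatMap-unique g xs uniq gu disjoint) λ (w∈gx , w∈rest) →
    let y , y∈xs , w∈gy = find (∈-concatMap⁻ g {xs = xs} w∈rest)
    in All.lookup x∉xs y∈xs (disjoint w∈gx w∈gy)

map-∷-unique : ∀ {A : Set} (x : A) ws → Unique ws → Unique (map (x ∷_) ws)
map-∷-unique x ws = Unique.map⁺ ∷-injectiveʳ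

map-∷-disjoint : ∀ {A : Set} {x y : A} {v : List A} {ws vs : List (List A)} →
                 v ∈ map (x ∷_) ws → v ∈ map (y ∷_) vs → x ≡ y
map-∷-disjoint {x = x} {y} v∈ v∈′
  with _ , _ , refl ← ∈-map⁻ (x ∷_) v∈
  with _ , _ , e ← ∈-map⁻ (y ∷_) v∈′ = ∷-injectiveˡ e

words-unique : ∀ xs n → Unique xs → Unique (words xs n)
words-unique xs zero    _    = All.[] ∷ []
words-unique xs (suc n) uniq =
  concatMap-unique _ xs uniq (λ x → map-∷-unique x _ (words-unique xs n uniq)) map-∷-disjoint

fillings-unique : ∀ xs λ′ → Unique xs → Unique (fillings xs λ′)
fillings-unique xs []        _    = All.[] ∷ []
fillings-unique xs (len ∷ λ′) uniq =
  concatMap-unique _ (words xs len) (words-unique xs len uniq)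
    (λ row → map-∷-unique row _ (fillings-unique xs λ′ uniq)) map-∷-disjoint

SYT-unique : ∀ λ′ → Unique (SYT λ′)
SYT-unique λ′ = Unique.filter⁺ _ (fillings-unique _ λ′ (Unique.map⁺ suc-injective (Unique.upTo⁺ _)))

swapEntries : ℕ → Filling → Filling
swapEntries v = map (map (swap v))

R-swapEntries : ∀ v T m → R (swapEntries v T) m ≡ R T (swap v m)
R-swapEntries v = R-map (swap v) (swap-involutive v)

R-swapEntries-beyond : ∀ v T m → suc v < m → R (swapEntries v T) m ≡ R T m
R-swapEntries-beyond v T m sv<m = trans (R-swapEntries v T m) (cong (R T) (swap-outside v m (inj₂ sv<m)))

swapEntries-involutive : ∀ v T → swapEntries v (swapEntries v T) ≡ T
swapEntries-involutive v T = begin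
  map (map (swap v)) (map (map (swap v)) T) ≡⟨ map-∘ T ⟨
  map (map (swap v) ∘′ map (swap v)) T      ≡⟨ map-cong swap-row T ⟩
  map id T                                  ≡⟨ map-id T ⟩
  T                                         ∎
  where
  open ≡-Reasoning
  swap-row : ∀ r → map (swap v) (map (swap v) r) ≡ id r
  swap-row r = trans (sym (map-∘ r)) (trans (map-cong (swap-involutive v) r) (map-id r))

-- cycleUp v n moves the entry v to v + n and lowers v + 1, …, v + n by one; cycleDown v n undoes it.
cycleUp : ℕ → ℕ → Filling → Filling
cycleUp v zero    T = T
cycleUp v (suc n) T = cycleUp (suc v) n (swapEntries v T)

cycleDown : ℕ → ℕ → Filling → Filling
cycleDown v zero    T = T
cycleDown v (suc n) T = swapEntries v (cycleDown (suc v) n T)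

cycleDown-cycleUp : ∀ n v T → cycleDown v n (cycleUp v n T) ≡ T
cycleDown-cycleUp zero    v T = refl
cycleDown-cycleUp (suc n) v T
  rewrite cycleDown-cycleUp n (suc v) (swapEntries v T) = swapEntries-involutive v T

cycleUp-cycleDown : ∀ n v T → cycleUp v n (cycleDown v n T) ≡ T
cycleUp-cycleDown zero    v T = refl
cycleUp-cycleDown (suc n) v T
  rewrite swapEntries-involutive v (cycleDown (suc v) n T) = cycleUp-cycleDown n (suc v) T

1+m≤m+1+n : ∀ m n → suc m ≤ m + suc n
1+m≤m+1+n m n = subst (suc m ≤_) (sym (+-suc m n)) (s≤s (m≤m+n m n))

private
  outside-suc : ∀ v n m → m < v ⊎ v + suc n < m → m < suc v ⊎ suc v + n < m
  outside-suc v n m (inj₁ m<v)   = inj₁ (m<n⇒m<1+n m<v)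
  outside-suc v n m (inj₂ v+n<m) = inj₂ (subst (_< m) (+-suc v n) v+n<m)

  outside-swap : ∀ v n m → m < v ⊎ v + suc n < m → m < v ⊎ suc v < m
  outside-swap v n m (inj₁ m<v)   = inj₁ m<v
  outside-swap v n m (inj₂ v+n<m) = inj₂ (≤-<-trans (1+m≤m+1+n v n) v+n<m)

R-cycleUp-last : ∀ n v T → R (cycleUp v n T) (v + n) ≡ R T v
R-cycleUp-last zero    v T rewrite +-identityʳ v = refl
R-cycleUp-last (suc n) v T
  rewrite +-suc v n | R-cycleUp-last n (suc v) (swapEntries v T) | R-swapEntries v T (suc v) | swap-right v = refl

R-cycleUp-outside : ∀ n v T m → m < v ⊎ v + n < m → R (cycleUp v n T) m ≡ R T m
R-cycleUp-outside zero    v T m _ = refl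
R-cycleUp-outside (suc n) v T m out
  rewrite R-cycleUp-outside n (suc v) (swapEntries v T) m (outside-suc v n m out)
        | R-swapEntries v T m | swap-outside v m (outside-swap v n m out) = refl

R-cycleUp-inside : ∀ n v T m → v ≤ m → m < v + n → R (cycleUp v n T) m ≡ R T (suc m)
R-cycleUp-inside zero    v T m v≤m m<v = ⊥-elim (<⇒≱ m<v (≤-trans (≤-reflexive (+-identityʳ v)) v≤m))
R-cycleUp-inside (suc n) v T m v≤m m<v+n with m ≟ v
... | yes refl
  rewrite R-cycleUp-outside n (suc v) (swapEntries v T) v (inj₁ (n<1+n v))
        | R-swapEntries v T v | swap-left v = refl
... | no m≢v
  rewrite R-cycleUp-inside n (suc v) (swapEntries v T) m (≤∧≢⇒< v≤m (≢-sym m≢v))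
                           (subst (m <_) (+-suc v n) m<v+n)
        | R-swapEntries v T (suc m) | swap-outside v (suc m) (inj₂ (s≤s (≤∧≢⇒< v≤m (≢-sym m≢v)))) = refl

R-cycleDown-first : ∀ n v T → R (cycleDown v n T) v ≡ R T (v + n)
R-cycleDown-first zero    v T rewrite +-identityʳ v = refl
R-cycleDown-first (suc n) v T
  rewrite R-swapEntries v (cycleDown (suc v) n T) v | swap-left v
        | R-cycleDown-first n (suc v) T | +-suc v n = refl

R-cycleDown-outside : ∀ n v T m → m < v ⊎ v + n < m → R (cycleDown v n T) m ≡ R T m
R-cycleDown-outside zero    v T m _ = refl
R-cycleDown-outside (suc n) v T m out
  rewrite R-swapEntries v (cycleDown (suc v) n T) m | swap-outside v m (outside-swap v n m out) =
  R-cycleDown-outside n (suc v) T m (outside-suc v n m out)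

R-cycleDown-inside : ∀ n v T m → v ≤ m → m < v + n → R (cycleDown v n T) (suc m) ≡ R T m
R-cycleDown-inside zero    v T m v≤m m<v = ⊥-elim (<⇒≱ m<v (≤-trans (≤-reflexive (+-identityʳ v)) v≤m))
R-cycleDown-inside (suc n) v T m v≤m m<v+n with m ≟ v
... | yes refl
  rewrite R-swapEntries v (cycleDown (suc v) n T) (suc v) | swap-right v =
  R-cycleDown-outside n (suc v) T v (inj₁ (n<1+n v))
... | no m≢v
  rewrite R-swapEntries v (cycleDown (suc v) n T) (suc m)
        | swap-outside v (suc m) (inj₂ (s≤s (≤∧≢⇒< v≤m (≢-sym m≢v)))) =
  R-cycleDown-inside n (suc v) T m (≤∧≢⇒< v≤m (≢-sym m≢v)) (subst (m <_) (+-suc v n) m<v+n)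

module Tableaux (λ′ : List ℕ) where

  k : ℕ
  k = sum λ′

  entries : List ℕ
  entries = map suc (upTo k)

  Standard : Filling → Set
  Standard T = T ∈ fillings entries λ′ × IsTrue (isSYTᵇ k T)

  ∈SYT⇒Standard : ∀ {T} → T ∈ SYT λ′ → Standard T
  ∈SYT⇒Standard = ∈-filter⁻ (λ T → T? (isSYTᵇ k T)) {xs = fillings entries λ′}

  Standard⇒∈SYT : ∀ {T} → Standard T → T ∈ SYT λ′
  Standard⇒∈SYT (T∈ , syt) = ∈-filter⁺ (λ T → T? (isSYTᵇ k T)) T∈ syt

  entries-∈⁺ : ∀ {m} → 1 ≤ m → m ≤ k → m ∈ entries
  entries-∈⁺ {suc m} _ m≤k = ∈-map⁺ suc (∈-upTo⁺ m≤k)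

  swap-entries : ∀ {v m} → 1 ≤ v → suc v ≤ k → m ∈ entries → swap v m ∈ entries
  swap-entries {v} {m} 1≤v sv≤k m∈ with m ≟ v
  ... | yes refl rewrite swap-left v = entries-∈⁺ (s≤s z≤n) sv≤k
  ... | no m≢v with m ≟ suc v
  ...   | yes refl rewrite swap-right v = entries-∈⁺ 1≤v (≤-trans (n≤1+n v) sv≤k)
  ...   | no m≢sv rewrite swap-other v m m≢v m≢sv = m∈

  module _ {T : Filling} (std : Standard T) where

    Standard-bijective : IsTrue (bijectiveᵇ k T)
    Standard-bijective = IsTrue-∧ˡ (proj₂ std)

    Standard-rows : IsTrue (allᵇ rowIncᵇ T)
    Standard-rows = IsTrue-∧ˡ (IsTrue-∧ʳ {bijectiveᵇ k T} (proj₂ std))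

    Standard-columns : IsTrue (colIncᵇ T)
    Standard-columns = IsTrue-∧ʳ {allᵇ rowIncᵇ T} (IsTrue-∧ʳ {bijectiveᵇ k T} (proj₂ std))

    Standard-row : ∀ {i r} → RowAt i r T → IsTrue (rowIncᵇ r)
    Standard-row r∈ = allᵇ-∈ rowIncᵇ T Standard-rows (RowAt⇒∈ r∈)

    Standard-once : ∀ {m} → m ∈ entries → countᵇ m (concat T) ≡ 1
    Standard-once {m} m∈ =
      ≡ᵇ⇒≡ _ 1 (allᵇ-∈ (λ m → countᵇ m (concat T) ≡ᵇ 1) entries
                  (IsTrue-∧ʳ {length (concat T) ≡ᵇ k} Standard-bijective) m∈)

    Standard-InRow-R : ∀ {m} → 1 ≤ m → m ≤ k → InRow m (R T m) T
    Standard-InRow-R 1≤m m≤k =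
      InRow-R T (count-pos⇒∈ (concat T) (≤-reflexive (sym (Standard-once (entries-∈⁺ 1≤m m≤k)))))

    Standard-R : ∀ {m i} → 1 ≤ m → m ≤ k → InRow m i T → R T m ≡ i
    Standard-R 1≤m m≤k m∈i = InRow⇒R≡ m∈i (Standard-once (entries-∈⁺ 1≤m m≤k))

  swapEntries-standard : ∀ {v T} → Standard T → 1 ≤ v → suc v ≤ k →
                         R T v ≢ R T (suc v) → ¬ Above v (suc v) T → Standard (swapEntries v T)
  swapEntries-standard {v} {T} std 1≤v sv≤k rows≢ ¬above =
    fillings-map (swap v) entries λ′ (swap-entries 1≤v sv≤k) (proj₁ std) ,
    IsTrue-∧⁺ bijective (IsTrue-∧⁺ rows columns)
    where
    v≤k : v ≤ k
    v≤k = ≤-trans (n≤1+n v) sv≤k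

    bijective : IsTrue (bijectiveᵇ k (swapEntries v T))
    bijective rewrite concat-map {f = swap v} T | length-map (swap v) (concat T) =
      IsTrue-∧⁺ (IsTrue-∧ˡ (Standard-bijective std))
        (allᵇ-intro _ entries λ m∈ →
          subst (λ c → IsTrue (c ≡ᵇ 1)) (sym (count-map (swap v) (swap-involutive v) _ (concat T)))
            (≡⇒≡ᵇ _ 1 (Standard-once std (swap-entries 1≤v sv≤k m∈))))

    rows : IsTrue (allᵇ rowIncᵇ (swapEntries v T))
    rows = allᵇ-rowIncᵇ-map (swap v) T λ {_} {r} r∈ {a} {b} ab →
      swap-< v a b (rowIncᵇ-Adjacent r (Standard-row std r∈) ab) λ { (refl , refl) →
        rows≢ (trans (Standard-R std 1≤v v≤k (r , r∈ , Adjacent-∈ˡ ab))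
                     (sym (Standard-R std (s≤s z≤n) sv≤k (r , r∈ , Adjacent-∈ʳ ab)))) }

    columns : IsTrue (colIncᵇ (swapEntries v T))
    columns = colIncᵇ-map (swap v) T (Standard-columns std) λ {a} {b} ab →
      swap-< v a b (colIncᵇ-Above T (Standard-columns std) ab) λ { (refl , refl) → ¬above ab }

  Above⇒R : ∀ {T a} → Standard T → 1 ≤ a → suc a ≤ k → Above a (suc a) T → R T (suc a) ≡ suc (R T a)
  Above⇒R {T} std 1≤a sa≤k ab =
    trans (Standard-R std (s≤s z≤n) sa≤k (lower , lowerAt , Stacked-∈ʳ stacked))
          (cong suc (sym (Standard-R std 1≤a (≤-trans (n≤1+n _) sa≤k) (upper , upperAt , Stacked-∈ˡ stacked))))
    where open AboveWitness (Above-witness T (Standard-columns std) ab)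

  module _ {T u} (std : Standard T) (1≤u : 1 ≤ u) (ssu≤k : suc (suc u) ≤ k) where

    private
      su≤k : suc u ≤ k
      su≤k = ≤-trans (n≤1+n (suc u)) ssu≤k

    same-row⇒¬Above-next : R T u ≡ R T (suc u) → ¬ Above (suc u) (suc (suc u)) T
    same-row⇒¬Above-next same ab = 1+n≢n (trans (sym (Standard-R std (s≤s z≤n) su≤k su-lower)) su-upper)
      where
      open AboveWitness (Above-witness T (Standard-columns std) ab)
      su-upper : R T (suc u) ≡ i
      su-upper = Standard-R std (s≤s z≤n) su≤k (upper , upperAt , Stacked-∈ˡ stacked)
      u∈upper : u ∈ upper
      u∈upper = InRow-RowAt (subst (λ j → InRow u j T) (trans same su-upper)
                  (Standard-InRow-R std 1≤u (≤-trans (n≤1+n u) su≤k))) upperAt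
      su-lower : InRow (suc u) (suc i) T
      su-lower = lower , lowerAt ,
        squeezed-below upper lower (Standard-row std upperAt) (Standard-row std lowerAt) below
          (rowIncᵇ-consecutive upper (Standard-row std upperAt) u∈upper (Stacked-∈ˡ stacked)) stacked

    same-row⇒¬Above-prev : R T (suc u) ≡ R T (suc (suc u)) → ¬ Above u (suc u) T
    same-row⇒¬Above-prev same ab = 1+n≢n (trans (sym su-lower) (Standard-R std (s≤s z≤n) su≤k su-upper))
      where
      open AboveWitness (Above-witness T (Standard-columns std) ab)
      su-lower : R T (suc u) ≡ suc i
      su-lower = Standard-R std (s≤s z≤n) su≤k (lower , lowerAt , Stacked-∈ʳ stacked)
      ssu∈lower : suc (suc u) ∈ lower
      ssu∈lower = InRow-RowAt (subst (λ j → InRow (suc (suc u)) j T) (trans (sym same) su-lower)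
                    (Standard-InRow-R std (s≤s z≤n) ssu≤k)) lowerAt
      su-upper : InRow (suc u) i T
      su-upper = upper , upperAt ,
        squeezed-above upper lower (Standard-row std upperAt) (Standard-row std lowerAt) below
          (rowIncᵇ-consecutive lower (Standard-row std lowerAt) (Stacked-∈ʳ stacked) ssu∈lower) stacked

  -- Step i exchanges v + i, still in the box of v, with v + i + 1.  Only the first step acts on T itself;
  -- at later steps "directly above" is excluded by the row of v + i + 1 (dually for cycleDown-standard).
  cycleUp-standard : ∀ n v {T} → Standard T → 1 ≤ v → v + n ≤ k →
    (∀ i → i < n → R T v ≢ R T (v + suc i)) →
    (0 < n → ¬ Above v (suc v) T) →
    (∀ i → 0 < i → i < n → R T (v + suc i) ≢ suc (R T v)) →
    Standard (cycleUp v n T)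
  cycleUp-standard zero    v std _ _ _ _ _ = std
  cycleUp-standard (suc n) v {T} std 1≤v v+n≤k apart ¬above not-below =
    cycleUp-standard n (suc v) std′ (s≤s z≤n) (subst (_≤ k) (+-suc v n) v+n≤k) apart′ ¬above′ not-below′
    where
    sv≤k : suc v ≤ k
    sv≤k = ≤-trans (1+m≤m+1+n v n) v+n≤k
    T′ : Filling
    T′ = swapEntries v T
    R′-moved : R T′ (suc v) ≡ R T v
    R′-moved = trans (R-swapEntries v T (suc v)) (cong (R T) (swap-right v))
    R′-beyond : ∀ i → R T′ (suc v + suc i) ≡ R T (v + suc (suc i))
    R′-beyond i = trans (R-swapEntries-beyond v T _ (s≤s (1+m≤m+1+n v i))) (cong (R T) (sym (+-suc v (suc i))))
    std′ : Standard T′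
    std′ = swapEntries-standard std 1≤v sv≤k
             (subst (λ m → R T v ≢ R T m) (+-comm v 1) (apart 0 (s≤s z≤n))) (¬above (s≤s z≤n))
    apart′ : ∀ i → i < n → R T′ (suc v) ≢ R T′ (suc v + suc i)
    apart′ i i<n e = apart (suc i) (s≤s i<n) (trans (sym R′-moved) (trans e (R′-beyond i)))
    ¬above′ : 0 < n → ¬ Above (suc v) (suc (suc v)) T′
    ¬above′ 0<n ab = not-below 1 (s≤s z≤n) (s≤s 0<n) (begin
      R T (v + 2)           ≡⟨ cong (R T) (+-comm v 2) ⟩
      R T (suc (suc v))     ≡⟨ R-swapEntries-beyond v T (suc (suc v)) ≤-refl ⟨
      R T′ (suc (suc v))    ≡⟨ Above⇒R std′ (s≤s z≤n) ssv≤k ab ⟩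
      suc (R T′ (suc v))    ≡⟨ cong suc R′-moved ⟩
      suc (R T v)           ∎)
      where
      open ≡-Reasoning
      ssv≤k : suc (suc v) ≤ k
      ssv≤k = ≤-trans (s≤s (subst (_≤ v + n) (+-comm v 1) (+-monoʳ-≤ v 0<n)))
                      (subst (_≤ k) (+-suc v n) v+n≤k)
    not-below′ : ∀ i → 0 < i → i < n → R T′ (suc v + suc i) ≢ suc (R T′ (suc v))
    not-below′ i 0<i i<n e = not-below (suc i) (s≤s z≤n) (s≤s i<n)
      (trans (sym (R′-beyond i)) (trans e (cong suc R′-moved)))

  cycleDown-standard : ∀ n v {T} → Standard T → 1 ≤ v → v + n ≤ k →
    (∀ i → i < n → R T (v + i) ≢ R T (v + n)) →
    (∀ m → n ≡ suc m → ¬ Above (v + m) (suc (v + m)) T) →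
    (∀ i → suc i < n → R T (v + n) ≢ suc (R T (v + i))) →
    Standard (cycleDown v n T)
  cycleDown-standard zero    v std _ _ _ _ _ = std
  cycleDown-standard (suc n) v {T} std 1≤v v+n≤k apart ¬above not-below =
    swapEntries-standard D-std 1≤v (≤-trans (1+m≤m+1+n v n) v+n≤k) apartD ¬aboveD
    where
    D : Filling
    D = cycleDown (suc v) n T
    apart′ : ∀ i → i < n → R T (suc v + i) ≢ R T (suc v + n)
    apart′ i i<n e = apart (suc i) (s≤s i<n)
      (subst₂ (λ a b → R T a ≡ R T b) (sym (+-suc v i)) (sym (+-suc v n)) e)
    ¬above′ : ∀ m → n ≡ suc m → ¬ Above (suc v + m) (suc (suc v + m)) T
    ¬above′ m refl = subst (λ a → ¬ Above a (suc a) T) (+-suc v m) (¬above (suc m) refl)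
    not-below′ : ∀ i → suc i < n → R T (suc v + n) ≢ suc (R T (suc v + i))
    not-below′ i si<n e = not-below (suc i) (s≤s si<n)
      (subst₂ (λ a b → R T a ≡ suc (R T b)) (sym (+-suc v n)) (sym (+-suc v i)) e)
    D-std : Standard D
    D-std = cycleDown-standard n (suc v) std (s≤s z≤n) (subst (_≤ k) (+-suc v n) v+n≤k)
              apart′ ¬above′ not-below′
    D-moved : R D (suc v) ≡ R T (v + suc n)
    D-moved = trans (R-cycleDown-first n (suc v) T) (cong (R T) (sym (+-suc v n)))
    D-fixed : R D v ≡ R T (v + 0)
    D-fixed = trans (R-cycleDown-outside n (suc v) T v (inj₁ (n<1+n v))) (cong (R T) (sym (+-identityʳ v)))
    apartD : R D v ≢ R D (suc v)
    apartD e = apart 0 (s≤s z≤n) (trans (sym D-fixed) (trans e D-moved))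
    ¬aboveD : ¬ Above v (suc v) D
    ¬aboveD ab with n ≟ 0
    ... | yes n≡0 = subst (λ a → ¬ Above a (suc a) T) (+-identityʳ v) (¬above 0 (cong suc n≡0))
                      (subst (λ m → Above v (suc v) (cycleDown (suc v) m T)) n≡0 ab)
    ... | no n≢0 = not-below 0 (s≤s (n≢0⇒n>0 n≢0))
                     (trans (sym D-moved) (trans (Above⇒R D-std 1≤v (≤-trans (1+m≤m+1+n v n) v+n≤k) ab)
                                                 (cong suc D-fixed)))

Ascending : (ℕ → ℕ) → ℕ → ℕ → Set
Ascending g lo hi = ∀ i → lo ≤ i → suc i ≤ hi → g i < g (suc i)

Ascending⇒< : ∀ {g lo hi} → Ascending g lo hi → ∀ {a b} → lo ≤ a → a < b → b ≤ hi → g a < g b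
Ascending⇒< asc {a} {suc b} lo≤a (s≤s a≤b) sb≤hi with a ≟ b
... | yes refl = asc a lo≤a sb≤hi
... | no a≢b   = <-trans (Ascending⇒< asc lo≤a (≤∧≢⇒< a≤b a≢b) (≤-trans (n≤1+n b) sb≤hi))
                         (asc b (≤-trans lo≤a a≤b) sb≤hi)

Ascending-extendˡ : ∀ {g lo hi} → g lo < g (suc lo) → Ascending g (suc lo) hi → Ascending g lo hi
Ascending-extendˡ bottom asc i lo≤i si≤hi with m≤n⇒m<n∨m≡n lo≤i
... | inj₁ lo<i = asc i lo<i si≤hi
... | inj₂ refl = bottom

Ascending-extendʳ : ∀ {g lo hi} → g hi < g (suc hi) → Ascending g lo hi → Ascending g lo (suc hi)
Ascending-extendʳ top asc i lo≤i (s≤s i≤hi) with m≤n⇒m<n∨m≡n i≤hi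
... | inj₁ i<hi = asc i lo≤i i<hi
... | inj₂ refl = top

Ascending-restrict : ∀ {g lo hi lo′ hi′} → lo ≤ lo′ → hi′ ≤ hi → Ascending g lo hi →
                     Ascending g lo′ hi′
Ascending-restrict lo≤lo′ hi′≤hi asc i lo′≤i si≤hi′ =
  asc i (≤-trans lo≤lo′ lo′≤i) (≤-trans si≤hi′ hi′≤hi)

prefixLength : (ℕ → Bool) → ℕ → ℕ
prefixLength p zero    = 0
prefixLength p (suc n) = if p 0 then suc (prefixLength (p ∘′ suc) n) else 0

prefixLength-≤ : ∀ p n → prefixLength p n ≤ n
prefixLength-≤ p zero    = z≤n
prefixLength-≤ p (suc n) with p 0
... | true  = s≤s (prefixLength-≤ (p ∘′ suc) n)
... | false = z≤n

prefixLength-true : ∀ p n {i} → i < prefixLength p n → IsTrue (p i)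
prefixLength-true p (suc n) {i} i< with p 0 in p0
prefixLength-true p (suc n) {zero}  _        | true = subst IsTrue (sym p0) _
prefixLength-true p (suc n) {suc i} (s≤s i<) | true = prefixLength-true (p ∘′ suc) n i<

prefixLength-false : ∀ p n → prefixLength p n < n → ¬ IsTrue (p (prefixLength p n))
prefixLength-false p (suc n) len<n with p 0 in p0
... | true  = prefixLength-false (p ∘′ suc) n (≤-pred len<n)
... | false = subst IsTrue p0

prefixLength-unique : ∀ p n c → c ≤ n → (∀ {i} → i < c → IsTrue (p i)) → (c < n → ¬ IsTrue (p c)) →
                      prefixLength p n ≡ c
prefixLength-unique p zero    zero    _         _    _     = refl
prefixLength-unique p (suc n) zero    _         _    stops with p 0
... | true  = ⊥-elim (stops (s≤s z≤n) _)
... | false = refl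
prefixLength-unique p (suc n) (suc c) (s≤s c≤n) holds stops with p 0 in p0
... | true  = cong suc (prefixLength-unique (p ∘′ suc) n c c≤n (λ i<c → holds (s≤s i<c)) (stops ∘′ s≤s))
... | false = ⊥-elim (subst IsTrue p0 (holds (s≤s z≤n)))

-- descentCondᵇ keeps the indices 1 ≤ i < h by a test local to its definition; only its values at 0
-- and at successors are needed.
allᵇ-filterᵇ-upTo : (p q : ℕ → Bool) → (∀ i → IsTrue (q (suc i))) → ¬ IsTrue (q 0) → ∀ h →
  IsTrue (allᵇ p (filterᵇ q (upTo h))) ⇔ (∀ i → 1 ≤ i → i < h → IsTrue (p i))
allᵇ-filterᵇ-upTo p q q-suc ¬q-0 h = mk⇔
  (λ { all (suc i) _ i<h → allᵇ-∈ p _ all (∈-filter⁺ (λ x → T? (q x)) (∈-upTo⁺ i<h) (q-suc i)) })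
  (λ ps → allᵇ-intro p _ λ i∈ →
     let i∈upTo , qi = ∈-filter⁻ (λ x → T? (q x)) {xs = upTo h} i∈
     in ps _ (positive qi) (∈-upTo⁻ i∈upTo))
  where
  positive : ∀ {i} → IsTrue (q i) → 1 ≤ i
  positive {zero}  q0 = ⊥-elim (¬q-0 q0)
  positive {suc i} _  = s≤s z≤n

descentCondᵇ⇔ : ∀ h a T →
  IsTrue (descentCondᵇ h a T) ⇔ (∀ i → 1 ≤ i → i < h → R T (i + a) < R T (i + 1 + a))
descentCondᵇ⇔ h a T = mk⇔
  (λ d i 1≤i i<h → <ᵇ⇒< _ _ (Equivalence.to (allᵇ-filterᵇ-upTo _ _ (λ _ → _) (λ ()) h) d i 1≤i i<h))
  (λ asc → Equivalence.from (allᵇ-filterᵇ-upTo _ _ (λ _ → _) (λ ()) h)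
             λ i 1≤i i<h → <⇒<ᵇ (asc i 1≤i i<h))

module Descents (λ′ : List ℕ) (h′ β : ℕ) (size : Tableaux.k λ′ ≡ suc β + suc h′) where
  open Tableaux λ′

  α h : ℕ
  α = suc β
  h = suc h′

  Y : Filling → ℕ → ℕ
  Y T i = R T (α + i)

  entry≤k : ∀ {i} → i ≤ h → α + i ≤ k
  entry≤k i≤h = subst (α + _ ≤_) (sym size) (+-monoʳ-≤ α i≤h)

  Above⇒Y : ∀ {T i} → Standard T → i < h → Above (α + i) (α + suc i) T → Y T (suc i) ≡ suc (Y T i)
  Above⇒Y {T} {i} std i<h ab =
    subst (λ m → R T m ≡ suc (Y T i)) (sym (+-suc α i))
      (Above⇒R std (s≤s z≤n) (subst (_≤ k) (+-suc α i) (entry≤k i<h))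
                             (subst (λ b → Above (α + i) b T) (+-suc α i) ab))

  private
    shift-< : ∀ a n {i} → i < a + n → α + i < α + a + n
    shift-< a n {i} i< = subst (α + i <_) (sym (+-assoc α a n)) (+-monoʳ-< α i<)

    shift-> : ∀ a n {i} → a + n < i → α + a + n < α + i
    shift-> a n {i} >i = subst (_< α + i) (sym (+-assoc α a n)) (+-monoʳ-< α >i)

  Y-cycleUp-inside : ∀ a n T {i} → a ≤ i → i < a + n → Y (cycleUp (α + a) n T) i ≡ Y T (suc i)
  Y-cycleUp-inside a n T {i} a≤i i< =
    trans (R-cycleUp-inside n (α + a) T (α + i) (+-monoʳ-≤ α a≤i) (shift-< a n i<))
          (cong (R T) (sym (+-suc α i)))

  Y-cycleUp-last : ∀ a n T → Y (cycleUp (α + a) n T) (a + n) ≡ Y T a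
  Y-cycleUp-last a n T = trans (cong (R (cycleUp (α + a) n T)) (sym (+-assoc α a n))) (R-cycleUp-last n (α + a) T)

  Y-cycleUp-outside : ∀ a n T {i} → i < a ⊎ a + n < i → Y (cycleUp (α + a) n T) i ≡ Y T i
  Y-cycleUp-outside a n T (inj₁ i<a) = R-cycleUp-outside n (α + a) T _ (inj₁ (+-monoʳ-< α i<a))
  Y-cycleUp-outside a n T (inj₂ a+n<i) =
    R-cycleUp-outside n (α + a) T _ (inj₂ (shift-> a n a+n<i))

  Y-cycleDown-inside : ∀ a n T {i} → a ≤ i → i < a + n → Y (cycleDown (α + a) n T) (suc i) ≡ Y T i
  Y-cycleDown-inside a n T {i} a≤i i< =
    trans (cong (R (cycleDown (α + a) n T)) (+-suc α i))
          (R-cycleDown-inside n (α + a) T (α + i) (+-monoʳ-≤ α a≤i) (shift-< a n i<))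

  Y-cycleDown-first : ∀ a n T → Y (cycleDown (α + a) n T) a ≡ Y T (a + n)
  Y-cycleDown-first a n T = trans (R-cycleDown-first n (α + a) T) (cong (R T) (+-assoc α a n))

  Y-cycleDown-outside : ∀ a n T {i} → i < a ⊎ a + n < i → Y (cycleDown (α + a) n T) i ≡ Y T i
  Y-cycleDown-outside a n T (inj₁ i<a) = R-cycleDown-outside n (α + a) T _ (inj₁ (+-monoʳ-< α i<a))
  Y-cycleDown-outside a n T (inj₂ a+n<i) =
    R-cycleDown-outside n (α + a) T _ (inj₂ (shift-> a n a+n<i))

  cycleUpʸ-standard : ∀ a n {T} → Standard T → a + n ≤ h →
    (∀ i → i < n → Y T a ≢ Y T (a + suc i)) →
    (0 < n → ¬ Above (α + a) (α + suc a) T) →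
    (∀ i → 0 < i → i < n → Y T (a + suc i) ≢ suc (Y T a)) →
    Standard (cycleUp (α + a) n T)
  cycleUpʸ-standard a n {T} std a+n≤h apart ¬above not-below =
    cycleUp-standard n (α + a) std (s≤s z≤n) (subst (_≤ k) (sym (+-assoc α a n)) (entry≤k a+n≤h))
      (λ i i<n → subst (λ m → Y T a ≢ R T m) (sym (+-assoc α a (suc i))) (apart i i<n))
      (λ 0<n → subst (λ m → ¬ Above (α + a) m T) (+-suc α a) (¬above 0<n))
      (λ i 0<i i<n → subst (λ m → R T m ≢ suc (Y T a)) (sym (+-assoc α a (suc i))) (not-below i 0<i i<n))

  cycleDownʸ-standard : ∀ a n {T} → Standard T → a + n ≤ h →
    (∀ i → i < n → Y T (a + i) ≢ Y T (a + n)) →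
    (∀ m → n ≡ suc m → ¬ Above (α + (a + m)) (α + suc (a + m)) T) →
    (∀ i → suc i < n → Y T (a + n) ≢ suc (Y T (a + i))) →
    Standard (cycleDown (α + a) n T)
  cycleDownʸ-standard a n {T} std a+n≤h apart ¬above not-below =
    cycleDown-standard n (α + a) std (s≤s z≤n) (subst (_≤ k) (sym (+-assoc α a n)) (entry≤k a+n≤h))
      (λ i i<n → subst₂ (λ x y → R T x ≢ R T y) (sym (+-assoc α a i)) (sym (+-assoc α a n)) (apart i i<n))
      (λ m n≡sm → subst (λ x → ¬ Above x (suc x) T) (sym (+-assoc α a m))
                    (subst (λ y → ¬ Above (α + (a + m)) y T) (+-suc α (a + m)) (¬above m n≡sm)))
      (λ i si<n → subst₂ (λ x y → R T x ≢ suc (R T y)) (sym (+-assoc α a n)) (sym (+-assoc α a i))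
                    (not-below i si<n))

  module _ {T i} (std : Standard T) (ssi≤h : suc (suc i) ≤ h) where

    private
      1≤α+i : 1 ≤ α + i
      1≤α+i = s≤s z≤n
      bound : suc (suc (α + i)) ≤ k
      bound = subst (_≤ k) (trans (+-suc α (suc i)) (cong suc (+-suc α i))) (entry≤k ssi≤h)

    same-rowʸ⇒¬Above-next : Y T i ≡ Y T (suc i) → ¬ Above (α + suc i) (α + suc (suc i)) T
    same-rowʸ⇒¬Above-next same =
      subst₂ (λ a b → ¬ Above a b T) (sym (+-suc α i)) (sym (trans (+-suc α (suc i)) (cong suc (+-suc α i))))
        (same-row⇒¬Above-next std 1≤α+i bound (trans same (cong (R T) (+-suc α i))))

    same-rowʸ⇒¬Above-prev : Y T (suc i) ≡ Y T (suc (suc i)) → ¬ Above (α + i) (α + suc i) T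
    same-rowʸ⇒¬Above-prev same =
      subst (λ b → ¬ Above (α + i) b T) (sym (+-suc α i))
        (same-row⇒¬Above-prev std 1≤α+i bound
          (subst₂ (λ a b → R T a ≡ R T b) (+-suc α i) (trans (+-suc α (suc i)) (cong suc (+-suc α i))) same))

  weaklyAboveFirst strictlyAboveLast : Filling → ℕ → Bool
  weaklyAboveFirst  T i = Y T (suc i) ≤ᵇ Y T 0
  strictlyAboveLast T i = Y T i <ᵇ Y T h

  weaklyAboveFirst-run : ∀ {T j} → prefixLength (weaklyAboveFirst T) h ≡ j →
                         (∀ {i} → i < j → Y T (suc i) ≤ Y T 0) × (j < h → Y T 0 < Y T (suc j))
  weaklyAboveFirst-run {T} refl =
    (λ i< → ≤ᵇ⇒≤ _ _ (prefixLength-true (weaklyAboveFirst T) h i<)) ,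
    (λ j<h → ≰⇒> λ le → prefixLength-false (weaklyAboveFirst T) h j<h (≤⇒≤ᵇ le))

  strictlyAboveLast-run : ∀ {T j} → prefixLength (strictlyAboveLast T) h ≡ j →
                          (∀ {i} → i < j → Y T i < Y T h) × (j < h → Y T h ≤ Y T j)
  strictlyAboveLast-run {T} refl =
    (λ i< → <ᵇ⇒< _ _ (prefixLength-true (strictlyAboveLast T) h i<)) ,
    (λ j<h → ≮⇒≥ λ lt → prefixLength-false (strictlyAboveLast T) h j<h (<⇒<ᵇ lt))

  -- move c turns the row sequence Y 0, …, Y h into Y 1, …, Y c, Y 0, Y (c + 2), …, Y h, Y (c + 1).
  move unmove : ℕ → Filling → Filling
  move   c T = cycleUp (α + suc c) (h ∸ suc c) (cycleUp (α + 0) c T)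
  unmove c T = cycleDown (α + 0) c (cycleDown (α + suc c) (h ∸ suc c) T)

  unmove-move : ∀ c T → unmove c (move c T) ≡ T
  unmove-move c T rewrite cycleDown-cycleUp (h ∸ suc c) (α + suc c) (cycleUp (α + 0) c T) =
    cycleDown-cycleUp c (α + 0) T

  move-unmove : ∀ c T → move c (unmove c T) ≡ T
  move-unmove c T rewrite cycleUp-cycleDown c (α + 0) (cycleDown (α + suc c) (h ∸ suc c) T) =
    cycleUp-cycleDown (h ∸ suc c) (α + suc c) T

  φ′ : ℕ → Filling → Filling
  φ′ zero    T = T
  φ′ (suc c) T = move c T

  ψ′ : ℕ → Filling → Filling
  ψ′ c T = if c ≡ᵇ h then T else unmove c T

  φ ψ : Filling → Filling
  φ T = φ′ (prefixLength (weaklyAboveFirst T) h) T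
  ψ T = ψ′ (prefixLength (strictlyAboveLast T) h) T

  module Forward {T} (std : Standard T) (asc : Ascending (Y T) 1 h)
                 (c : ℕ) (run : prefixLength (weaklyAboveFirst T) h ≡ suc c) where

    sc≤h : suc c ≤ h
    sc≤h = subst (_≤ h) run (prefixLength-≤ (weaklyAboveFirst T) h)

    weakly-above : ∀ {i} → i ≤ c → Y T (suc i) ≤ Y T 0
    weakly-above i≤c = proj₁ (weaklyAboveFirst-run {T} run) (s≤s i≤c)

    strictly-below : suc (suc c) ≤ h → Y T 0 < Y T (suc (suc c))
    strictly-below = proj₂ (weaklyAboveFirst-run {T} run)

    strictly-above : ∀ {i} → i < c → Y T (suc i) < Y T 0
    strictly-above i<c = <-≤-trans (Ascending⇒< asc (s≤s z≤n) (s≤s i<c) sc≤h) (weakly-above ≤-refl)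

    T₁ : Filling
    T₁ = cycleUp (α + 0) c T

    Y₁-shifted : ∀ {i} → i < c → Y T₁ i ≡ Y T (suc i)
    Y₁-shifted = Y-cycleUp-inside 0 c T z≤n

    Y₁-moved : Y T₁ c ≡ Y T 0
    Y₁-moved = Y-cycleUp-last 0 c T

    Y₁-fixed : ∀ {i} → c < i → Y T₁ i ≡ Y T i
    Y₁-fixed c<i = Y-cycleUp-outside 0 c T (inj₂ c<i)

    std₁ : Standard T₁
    std₁ = cycleUpʸ-standard 0 c std (<⇒≤ sc≤h)
      (λ i i<c → ≢-sym (<⇒≢ (strictly-above i<c)))
      (λ _ ab → <⇒≢ (s≤s (weakly-above z≤n)) (Above⇒Y std (s≤s z≤n) ab))
      (λ i _ i<c → <⇒≢ (s≤s (weakly-above (<⇒≤ i<c))))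

    n₂ : ℕ
    n₂ = h ∸ suc c

    sc+n₂≡h : suc c + n₂ ≡ h
    sc+n₂≡h = m+[n∸m]≡n sc≤h

    T₂ : Filling
    T₂ = cycleUp (α + suc c) n₂ T₁

    private
      in-window : ∀ {i} → i < n₂ → suc c + suc i ≤ h
      in-window {i} i<n₂ =
        subst (_≤ h) (sym (+-suc (suc c) i)) (subst (suc c + i <_) sc+n₂≡h (+-monoʳ-< (suc c) i<n₂))

      beyond : ∀ i → c < suc c + suc i
      beyond i = s≤s (m≤m+n c (suc i))

    std₂ : Standard T₂
    std₂ = cycleUpʸ-standard (suc c) n₂ std₁ (≤-reflexive sc+n₂≡h) apart ¬above not-below
      where
      apart : ∀ i → i < n₂ → Y T₁ (suc c) ≢ Y T₁ (suc c + suc i)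
      apart i i<n₂ rewrite Y₁-fixed (n<1+n c) | Y₁-fixed (beyond i) =
        <⇒≢ (Ascending⇒< asc (s≤s z≤n) (m<m+n (suc c) (s≤s z≤n)) (in-window i<n₂))
      ¬above : 0 < n₂ → ¬ Above (α + suc c) (α + suc (suc c)) T₁
      ¬above 0<n₂ ab = same-rowʸ⇒¬Above-next std₁ ssc≤h same-row ab
        where
        ssc≤h : suc (suc c) ≤ h
        ssc≤h = subst (_≤ h) (+-comm (suc c) 1) (in-window 0<n₂)
        stacked : Y T (suc (suc c)) ≡ suc (Y T (suc c))
        stacked = trans (sym (Y₁-fixed (s≤s (n≤1+n c))))
                    (trans (Above⇒Y std₁ ssc≤h ab) (cong suc (Y₁-fixed (n<1+n c))))
        same-row : Y T₁ c ≡ Y T₁ (suc c)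
        same-row = trans Y₁-moved (trans (≤-antisym (≤-pred (subst (Y T 0 <_) stacked (strictly-below ssc≤h)))
                                                    (weakly-above ≤-refl))
                                        (sym (Y₁-fixed (n<1+n c))))
      not-below : ∀ i → 0 < i → i < n₂ → Y T₁ (suc c + suc i) ≢ suc (Y T₁ (suc c))
      not-below (suc i) _ si<n₂ rewrite Y₁-fixed (n<1+n c) | Y₁-fixed (beyond (suc i)) =
        ≢-sym (<⇒≢ (≤-<-trans (Ascending⇒< asc (s≤s z≤n) (n<1+n (suc c))
                                             (≤-trans (<⇒≤ ssc<) (in-window si<n₂)))
                              (Ascending⇒< asc (s≤s z≤n) ssc< (in-window si<n₂))))
        where
        ssc< : suc (suc c) < suc c + suc (suc i)
        ssc< = subst (_< suc c + suc (suc i)) (+-comm (suc c) 1) (+-monoʳ-< (suc c) (s≤s (s≤s z≤n)))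

    Y₂-low : ∀ {i} → i < c → Y T₂ i ≡ Y T (suc i)
    Y₂-low i<c = trans (Y-cycleUp-outside (suc c) n₂ T₁ (inj₁ (m<n⇒m<1+n i<c))) (Y₁-shifted i<c)

    Y₂-moved : Y T₂ c ≡ Y T 0
    Y₂-moved = trans (Y-cycleUp-outside (suc c) n₂ T₁ (inj₁ (n<1+n c))) Y₁-moved

    Y₂-high : ∀ {i} → suc c ≤ i → i < h → Y T₂ i ≡ Y T (suc i)
    Y₂-high {i} sc≤i i<h = trans (Y-cycleUp-inside (suc c) n₂ T₁ sc≤i (subst (i <_) (sym sc+n₂≡h) i<h))
                            (Y₁-fixed (m<n⇒m<1+n sc≤i))

    Y₂-last : Y T₂ h ≡ Y T (suc c)
    Y₂-last = trans (cong (Y T₂) (sym sc+n₂≡h)) (trans (Y-cycleUp-last (suc c) n₂ T₁) (Y₁-fixed (n<1+n c)))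

    ascending₂ : Ascending (Y T₂) 0 h′
    ascending₂ i _ si<h′ with <-cmp i c
    ... | tri≈ _ refl _ rewrite Y₂-moved | Y₂-high ≤-refl (s≤s si<h′) = strictly-below (s≤s si<h′)
    ... | tri> _ _ c<i  rewrite Y₂-high c<i (m<n⇒m<1+n si<h′) | Y₂-high (m<n⇒m<1+n c<i) (s≤s si<h′) =
      asc (suc i) (s≤s z≤n) (s≤s si<h′)
    ... | tri< i<c _ _ with suc i ≟ c
    ...   | yes refl rewrite Y₂-low i<c | Y₂-moved = strictly-above i<c
    ...   | no si≢c rewrite Y₂-low i<c | Y₂-low (≤∧≢⇒< i<c si≢c) = asc (suc i) (s≤s z≤n) (s≤s si<h′)

    run₂ : prefixLength (strictlyAboveLast T₂) h ≡ c
    run₂ = prefixLength-unique (strictlyAboveLast T₂) h c (<⇒≤ sc≤h)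
      (λ i<c → <⇒<ᵇ (subst₂ _<_ (sym (Y₂-low i<c)) (sym Y₂-last)
                                (Ascending⇒< asc (s≤s z≤n) (s≤s i<c) sc≤h)))
      (λ _ below → ≤⇒≯ (weakly-above ≤-refl) (subst₂ _<_ Y₂-moved Y₂-last (<ᵇ⇒< _ _ below)))

    φ-move : φ T ≡ T₂
    φ-move = cong (λ j → φ′ j T) run

    ψ-unmove : ψ T₂ ≡ T
    ψ-unmove rewrite run₂ | ≢⇒≡ᵇ-false c h (<⇒≢ sc≤h) = unmove-move c T

  module Backward {T} (std : Standard T) (asc : Ascending (Y T) 0 h′)
                  (c : ℕ) (run : prefixLength (strictlyAboveLast T) h ≡ c) (c<h : c < h) where

    strictly-above : ∀ {i} → i < c → Y T i < Y T h
    strictly-above = proj₁ (strictlyAboveLast-run {T} run)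

    weakly-below : Y T h ≤ Y T c
    weakly-below = proj₂ (strictlyAboveLast-run {T} run) c<h

    n₂ : ℕ
    n₂ = h ∸ suc c

    sc+n₂≡h : suc c + n₂ ≡ h
    sc+n₂≡h = m+[n∸m]≡n c<h

    private
      in-window : ∀ {i} → suc c + i < h → suc c + i ≤ h′
      in-window = ≤-pred

      last-strictly-below : ∀ {i} → suc c + i < h → Y T h < Y T (suc c + i)
      last-strictly-below {i} si< =
        ≤-<-trans weakly-below (Ascending⇒< asc z≤n (s≤s (m≤m+n c i)) (in-window si<))

    D₁ : Filling
    D₁ = cycleDown (α + suc c) n₂ T

    Y₁-low : ∀ {i} → i ≤ c → Y D₁ i ≡ Y T i
    Y₁-low i≤c = Y-cycleDown-outside (suc c) n₂ T (inj₁ (s≤s i≤c))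

    Y₁-moved : Y D₁ (suc c) ≡ Y T h
    Y₁-moved = trans (Y-cycleDown-first (suc c) n₂ T) (cong (Y T) sc+n₂≡h)

    Y₁-shifted : ∀ {i} → suc c ≤ i → i < h → Y D₁ (suc i) ≡ Y T i
    Y₁-shifted {i} sc≤i i<h = Y-cycleDown-inside (suc c) n₂ T sc≤i (subst (i <_) (sym sc+n₂≡h) i<h)

    std₁ : Standard D₁
    std₁ = cycleDownʸ-standard (suc c) n₂ std (≤-reflexive sc+n₂≡h) apart ¬above not-below
      where
      window : ∀ {i} → i < n₂ → suc c + i < h
      window {i} i<n₂ = subst (suc c + i <_) sc+n₂≡h (+-monoʳ-< (suc c) i<n₂)
      apart : ∀ i → i < n₂ → Y T (suc c + i) ≢ Y T (suc c + n₂)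
      apart i i<n₂ rewrite sc+n₂≡h = ≢-sym (<⇒≢ (last-strictly-below (window i<n₂)))
      ¬above : ∀ m → n₂ ≡ suc m → ¬ Above (α + (suc c + m)) (α + suc (suc c + m)) T
      ¬above m n₂≡sm ab = <⇒≢ (m<n⇒m<1+n (last-strictly-below si<h))
        (trans (cong (Y T) (sym h≡)) (Above⇒Y std si<h ab))
        where
        h≡ : suc (suc c + m) ≡ h
        h≡ = trans (sym (+-suc (suc c) m)) (trans (cong (suc c +_) (sym n₂≡sm)) sc+n₂≡h)
        si<h : suc c + m < h
        si<h = subst (suc c + m <_) h≡ ≤-refl
      not-below : ∀ i → suc i < n₂ → Y T (suc c + n₂) ≢ suc (Y T (suc c + i))
      not-below i si<n₂ rewrite sc+n₂≡h =
        <⇒≢ (m<n⇒m<1+n (last-strictly-below (window (<-trans (n<1+n i) si<n₂))))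

    D₂ : Filling
    D₂ = cycleDown (α + 0) c D₁

    std₂ : Standard D₂
    std₂ = cycleDownʸ-standard 0 c std₁ (<⇒≤ c<h) apart ¬above not-below
      where
      c≤h′ : c ≤ h′
      c≤h′ = ≤-pred c<h
      apart : ∀ i → i < c → Y D₁ i ≢ Y D₁ c
      apart i i<c rewrite Y₁-low (<⇒≤ i<c) | Y₁-low ≤-refl = <⇒≢ (Ascending⇒< asc z≤n i<c c≤h′)
      ¬above : ∀ m → c ≡ suc m → ¬ Above (α + m) (α + suc m) D₁
      ¬above m refl ab = same-rowʸ⇒¬Above-prev std₁ c<h (trans (Y₁-low ≤-refl) (trans top (sym Y₁-moved))) ab
        where
        stacked : Y T (suc m) ≡ suc (Y T m)
        stacked = trans (sym (Y₁-low ≤-refl)) (trans (Above⇒Y std₁ (<-trans (n<1+n m) c<h) ab)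
                                                     (cong suc (Y₁-low (n≤1+n m))))
        top : Y T (suc m) ≡ Y T h
        top = ≤-antisym (subst (_≤ Y T h) (sym stacked) (strictly-above (n<1+n m))) weakly-below
      not-below : ∀ i → suc i < c → Y D₁ c ≢ suc (Y D₁ i)
      not-below i si<c rewrite Y₁-low ≤-refl | Y₁-low (<⇒≤ (<-trans (n<1+n i) si<c)) =
        ≢-sym (<⇒≢ (≤-<-trans (Ascending⇒< asc z≤n (n<1+n i) (≤-trans (<⇒≤ si<c) c≤h′))
                              (Ascending⇒< asc z≤n si<c c≤h′)))

    Y₂-first : Y D₂ 0 ≡ Y T c
    Y₂-first = trans (Y-cycleDown-first 0 c D₁) (Y₁-low ≤-refl)

    Y₂-low : ∀ {i} → i < c → Y D₂ (suc i) ≡ Y T i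
    Y₂-low i<c = trans (Y-cycleDown-inside 0 c D₁ z≤n i<c) (Y₁-low (<⇒≤ i<c))

    Y₂-moved : Y D₂ (suc c) ≡ Y T h
    Y₂-moved = trans (Y-cycleDown-outside 0 c D₁ (inj₂ (n<1+n c))) Y₁-moved

    Y₂-high : ∀ {i} → c < i → i < h → Y D₂ (suc i) ≡ Y T i
    Y₂-high c<i i<h = trans (Y-cycleDown-outside 0 c D₁ (inj₂ (m<n⇒m<1+n c<i))) (Y₁-shifted c<i i<h)

    ascending₂ : Ascending (Y D₂) 1 h
    ascending₂ (suc i) _ ssi≤h with <-cmp i c
    ... | tri≈ _ refl _ rewrite Y₂-moved | Y₂-high (n<1+n i) ssi≤h =
      ≤-<-trans weakly-below (asc i z≤n (≤-pred ssi≤h))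
    ... | tri> _ _ c<i  rewrite Y₂-high c<i (<-trans (n<1+n i) ssi≤h) | Y₂-high (m<n⇒m<1+n c<i) ssi≤h =
      asc i z≤n (≤-pred ssi≤h)
    ... | tri< i<c _ _ with suc i ≟ c
    ...   | yes refl rewrite Y₂-low i<c | Y₂-moved = strictly-above i<c
    ...   | no si≢c rewrite Y₂-low i<c | Y₂-low (≤∧≢⇒< i<c si≢c) = asc i z≤n (≤-pred ssi≤h)

    run₂ : prefixLength (weaklyAboveFirst D₂) h ≡ suc c
    run₂ = prefixLength-unique (weaklyAboveFirst D₂) h (suc c) c<h holds stops
      where
      holds : ∀ {i} → i < suc c → IsTrue (weaklyAboveFirst D₂ i)
      holds {i} (s≤s i≤c) with m≤n⇒m<n∨m≡n i≤c
      ... | inj₁ i<c  = ≤⇒≤ᵇ (subst₂ _≤_ (sym (Y₂-low i<c)) (sym Y₂-first)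
                                        (<⇒≤ (Ascending⇒< asc z≤n i<c (≤-pred c<h))))
      ... | inj₂ refl = ≤⇒≤ᵇ (subst₂ _≤_ (sym Y₂-moved) (sym Y₂-first) weakly-below)
      stops : suc c < h → ¬ IsTrue (weaklyAboveFirst D₂ (suc c))
      stops sc<h le = <⇒≱ (asc c z≤n (≤-pred sc<h))
        (subst₂ _≤_ (Y₂-high (n<1+n c) sc<h) Y₂-first (≤ᵇ⇒≤ _ _ le))

    ψ-unmove : ψ T ≡ D₂
    ψ-unmove rewrite run | ≢⇒≡ᵇ-false c h (<⇒≢ c<h) = refl

    φ-move : φ D₂ ≡ T
    φ-move rewrite run₂ = move-unmove c T

  φ-fixed : ∀ {T} → Ascending (Y T) 0 h → φ T ≡ T
  φ-fixed {T} asc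
    rewrite prefixLength-unique (weaklyAboveFirst T) h 0 z≤n (λ ())
              (λ _ le → <⇒≱ (asc 0 z≤n (s≤s z≤n)) (≤ᵇ⇒≤ _ _ le)) = refl

  ψ-fixed : ∀ {T} → Ascending (Y T) 0 h → ψ T ≡ T
  ψ-fixed {T} asc
    rewrite prefixLength-unique (strictlyAboveLast T) h h ≤-refl
              (λ i<h → <⇒<ᵇ (Ascending⇒< asc z≤n i<h ≤-refl)) (λ h<h → ⊥-elim (<-irrefl refl h<h))
          | ≡ᵇ-refl h = refl

  no-run⇒Ascending : ∀ {T} → Ascending (Y T) 1 h → prefixLength (weaklyAboveFirst T) h ≡ 0 →
                     Ascending (Y T) 0 h
  no-run⇒Ascending {T} asc run = Ascending-extendˡ (proj₂ (weaklyAboveFirst-run {T} run) (s≤s z≤n)) asc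

  full-run⇒Ascending : ∀ {T} → Ascending (Y T) 0 h′ → prefixLength (strictlyAboveLast T) h ≡ h →
                       Ascending (Y T) 0 h
  full-run⇒Ascending {T} asc run = Ascending-extendʳ (proj₁ (strictlyAboveLast-run {T} run) ≤-refl) asc

  φ-correct : ∀ {T} → Standard T → Ascending (Y T) 1 h →
              (Standard (φ T) × Ascending (Y (φ T)) 0 h′) × ψ (φ T) ≡ T
  φ-correct {T} std asc with prefixLength (weaklyAboveFirst T) h in run
  ... | zero  = (std , Ascending-restrict z≤n (n≤1+n h′) asc₀) , ψ-fixed {T} asc₀
    where
    asc₀ : Ascending (Y T) 0 h
    asc₀ = no-run⇒Ascending {T} asc run
  ... | suc c = (std₂ , ascending₂) , ψ-unmove
    where open Forward std asc c run

  ψ-correct : ∀ {T} → Standard T → Ascending (Y T) 0 h′ →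
              (Standard (ψ T) × Ascending (Y (ψ T)) 1 h) × φ (ψ T) ≡ T
  ψ-correct {T} std asc with prefixLength (strictlyAboveLast T) h ≟ h
  ... | yes run = subst (λ U → (Standard U × Ascending (Y U) 1 h) × φ U ≡ T) (sym (ψ-fixed {T} asc₀))
                    ((std , Ascending-restrict z≤n ≤-refl asc₀) , φ-fixed {T} asc₀)
    where
    asc₀ : Ascending (Y T) 0 h
    asc₀ = full-run⇒Ascending {T} asc run
  ... | no run≢h = subst (λ U → (Standard U × Ascending (Y U) 1 h) × φ U ≡ T) (sym ψ-unmove)
                     ((std₂ , ascending₂) , φ-move)
    where open Backward std asc _ refl (≤∧≢⇒< (prefixLength-≤ (strictlyAboveLast T) h) run≢h)

  descentCondᵇ-α⇔ : ∀ T → IsTrue (descentCondᵇ h α T) ⇔ Ascending (Y T) 1 h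
  descentCondᵇ-α⇔ T = mk⇔
    (λ d i 1≤i si≤h → subst₂ (λ a b → R T a < R T b) (+-comm i α) (index i)
                        (Equivalence.to (descentCondᵇ⇔ h α T) d i 1≤i si≤h))
    (λ asc → Equivalence.from (descentCondᵇ⇔ h α T) λ i 1≤i si≤h →
       subst₂ (λ a b → R T a < R T b) (sym (+-comm i α)) (sym (index i)) (asc i 1≤i si≤h))
    where
    index : ∀ i → i + 1 + α ≡ α + suc i
    index i = trans (+-comm (i + 1) α) (cong (α +_) (+-comm i 1))

  descentCondᵇ-β⇔ : ∀ T → IsTrue (descentCondᵇ h β T) ⇔ Ascending (Y T) 0 h′
  descentCondᵇ-β⇔ T = mk⇔
    (λ d i _ si≤h′ → subst₂ (λ a b → R T a < R T b) (index₀ i) (index₁ i)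
                        (Equivalence.to (descentCondᵇ⇔ h β T) d (suc i) (s≤s z≤n) (s≤s si≤h′)))
    (λ asc → Equivalence.from (descentCondᵇ⇔ h β T) λ { (suc i) _ (s≤s si≤h′) →
       subst₂ (λ a b → R T a < R T b) (sym (index₀ i)) (sym (index₁ i)) (asc i z≤n si≤h′) })
    where
    index₀ : ∀ i → suc i + β ≡ α + i
    index₀ i = cong suc (+-comm i β)
    index₁ : ∀ i → suc i + 1 + β ≡ α + suc i
    index₁ i = cong suc (trans (+-comm (i + 1) β) (cong (β +_) (+-comm i 1)))

  equinumerous : length (filterᵇ (descentCondᵇ h α) (SYT λ′)) ≡
                 length (filterᵇ (descentCondᵇ h β) (SYT λ′))
  equinumerous = ≤-antisym
    (length-filterᵇ-≤ (SYT λ′) (SYT-unique λ′) _ _ φ ψ λ {T} T∈ d →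
      let (std , asc) , inverse = φ-correct (∈SYT⇒Standard T∈) (Equivalence.to (descentCondᵇ-α⇔ T) d)
      in (Standard⇒∈SYT std , Equivalence.from (descentCondᵇ-β⇔ (φ T)) asc) , inverse)
    (length-filterᵇ-≤ (SYT λ′) (SYT-unique λ′) _ _ ψ φ λ {T} T∈ d →
      let (std , asc) , inverse = ψ-correct (∈SYT⇒Standard T∈) (Equivalence.to (descentCondᵇ-β⇔ T) d)
      in (Standard⇒∈SYT std , Equivalence.from (descentCondᵇ-α⇔ (ψ T)) asc) , inverse)

corollary4p8 : (h α : ℕ) → 0 < h → 0 < α →
               (λ′ : List ℕ) → λ′ ⊢ (h + α) →
               f λ′ h α ≡ f λ′ h (α ∸ 1)
corollary4p8 (suc h′) (suc β) _ _ λ′ partition =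
  Descents.equinumerous λ′ h′ β (trans (_⊢_.size partition) (+-comm (suc h′) (suc β)))
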